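{- For every integer $n \ge 1$ there exist rooted binary trees $S$ and $T$ on the vertex set $\{1,\dots,n\}$, each labeled in infix order, such that $S$ and $T$ have no pair of equivalent edges and $C(S,T) \ge n-1$.
   Context: Trees are rooted binary trees whose $n$ vertices are identified with $1,\dots,n$ in infix (in-order) order. A subtree rooted at $x$ is $x$ together with all its descendants. A pair of equivalent edges is an edge $e$ of $S$ and an edge $f$ of $T$ such that deleting $e$ splits $S$ into $S_1,S_2$ and deleting $f$ splits $T$ into $T_1,T_2$, where $S_1$ and $T_1$ are subtrees of $S$ and $T$ respectively with the same vertex set. The trees have no equivalent edges if no such pair exists. A left chain $[u$-$v]$ is a nonempty sequence of vertices $u=x_1,\dots,x_k=v$ with $x_{i+1}$ the left child of $x_i$; right chains are defined symmetrically. A direct c-rotation $\mathrm{rot}([u$-$v],w)$ applies when $[u$-$v]$ is a left chain and $u$ is the right child of $w$. Its effect: (i) $u$ takes the place of $w$ (as the child of $w$'s former parent on the same side, or as the root); (ii) $w$ becomes the left child of $v$; (iii) the former left subtree of $v$, if any, becomes the right subtree of $w$ (else $w$'s right child is empty). An inverse c-rotation $\mathrm{rot}(w,[u$-$v])$ applies when $[u$-$v]$ is a left chain and $w$ is the left child of $v$. Its effect: (i) $w$ takes the place of $u$; (ii) $u$ becomes the right child of $w$; (iii) the former right subtree of $w$, if any, becomes the left subtree of $v$ (else $v$'s left child is empty). The mirror-image operations for right chains (interchanging left and right) are also c-rotations. All other pointers are unchanged by a c-rotation. The chain distance $C(S,T)$ is the minimum number of c-rotations needed to transform $S$ into $T$.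 -}

module Defs where

open import Data.Nat using (ℕ; zero; suc; _+_; _∸_; _≤_)
open import Data.List using (List; []; _∷_; _++_; foldl)
open import Data.List.Membership.Propositional using (_∈_)
open import Data.Product using (Σ; _×_)
open import Function.Bundles using (_⇔_)
open import Relation.Nullary using (¬_)

-- Vertices are
-- identified with 1..n in infix order, so a tree on {1..n} is determined
-- by its shape; c-rotations preserve infix order, so they act on shapes.
data BT : Set where
  leaf : BT
  node : BT → BT → BT

size : BT → ℕ
size leaf = 0
size (node l r) = size l + suc (size r)

-- Left chain [u-v]: lc L Rv Rs is the subtree rooted at u, where the chain
-- goes u = x_1, ..., x_k = v along left children; L is v's left subtree,
-- Rv is v's right subtree, and Rs lists the right subtrees of
-- x_{k-1}, ..., x_1 (bottom to top).  k = 1 + length Rs ≥ 1.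
lc : BT → BT → List BT → BT
lc L Rv Rs = foldl (λ t R → node t R) (node L Rv) Rs

-- Right chain (mirror image): R is v's right subtree, Lv is v's left
-- subtree, Ls are the left subtrees of x_{k-1}, ..., x_1.
rc : BT → BT → List BT → BT
rc R Lv Ls = foldl (λ t L → node L t) (node Lv R) Ls

data RootRot : BT → BT → Set where
  -- direct c-rotation rot([u-v],w), left chain, u right child of w = node A _
  dirL : ∀ A L Rv Rs → RootRot (node A (lc L Rv Rs)) (lc (node A L) Rv Rs)
  -- inverse c-rotation rot(w,[u-v]), w = node A B left child of v
  invL : ∀ A B Rv Rs → RootRot (lc (node A B) Rv Rs) (node A (lc B Rv Rs))
  dirR : ∀ A R Lv Ls → RootRot (node (rc R Lv Ls) A) (rc (node R A) Lv Ls)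
  invR : ∀ A B Lv Ls → RootRot (rc (node B A) Lv Ls) (node (rc B Lv Ls) A)

data CRot : BT → BT → Set where
  here  : ∀ {s t} → RootRot s t → CRot s t
  inL   : ∀ {l l' r} → CRot l l' → CRot (node l r) (node l' r)
  inR   : ∀ {l r r'} → CRot r r' → CRot (node l r) (node l r')

data Steps : ℕ → BT → BT → Set where
  done : ∀ {s} → Steps 0 s s
  step : ∀ {k s t u} → CRot s t → Steps k t u → Steps (suc k) s u

ChainDistAtLeast : ℕ → BT → BT → Set
ChainDistAtLeast m S T = ∀ k → Steps k S T → m ≤ k

data LT : Set where
  lf : LT
  nd : LT → ℕ → LT → LT

-- infix labelling starting at o+1
label : ℕ → BT → LT
label o leaf = lf
label o (node l r) = nd (label o l) (o + suc (size l)) (label (o + suc (size l)) r)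

vertices : LT → List ℕ
vertices lf = []
vertices (nd l x r) = vertices l ++ (x ∷ vertices r)

data Sub : LT → LT → Set where
  here : ∀ {l x r} → Sub (nd l x r) (nd l x r)
  inL  : ∀ {l x r s} → Sub l s → Sub (nd l x r) s
  inR  : ∀ {l x r s} → Sub r s → Sub (nd l x r) s

-- EdgeSub t s : s is the subtree component obtained by deleting an edge
-- of t (the subtree rooted at the child endpoint of the edge).
data EdgeSub : LT → LT → Set where
  viaL : ∀ {l x r s} → Sub l s → EdgeSub (nd l x r) s
  viaR : ∀ {l x r s} → Sub r s → EdgeSub (nd l x r) s

SameVertexSet : LT → LT → Set
SameVertexSet s t = ∀ x → (x ∈ vertices s) ⇔ (x ∈ vertices t)

NoEquivalentEdges : LT → LT → Set
NoEquivalentEdges S T =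
  ∀ s t → EdgeSub S s → EdgeSub T t → ¬ SameVertexSet s t

-- Count the edges that lead to a left child.  A c-rotation only re-hangs
-- the edges at the two ends of its chain, while the chain itself keeps its
-- direction, so it changes this count by at most one.  The left path on n
-- vertices has n - 1 left edges and the right path has none, so at least
-- n - 1 c-rotations separate them.  They have no equivalent edges because
-- every edge-subtree of the left path contains vertex 1 and no edge-subtree
-- of the right path does.
module Submission where

open import Defs
open import Data.Nat using (ℕ; _≤_; _∸_)
open import Data.Product using (Σ; _×_)
open import Relation.Binary.PropositionalEquality using (_≡_)

open import Data.Nat using (zero; suc; _+_; _<_; z≤n; s≤s)
open import Data.Nat.Properties
open import Data.List using ([]; _∷_; map)
open import Data.Nat.ListAction using (sum)
open import Data.List.Membership.Propositional using (_∈_)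
open import Data.List.Membership.Propositional.Properties using (∈-++⁺ˡ; ∈-++⁺ʳ)
open import Data.List.Relation.Binary.Subset.Propositional using (_⊆_)
open import Data.List.Relation.Unary.Any using (here; there)
open import Data.Product using (_,_)
open import Function using (_∘_)
open import Function.Bundles using (Equivalence)
open import Relation.Binary.PropositionalEquality using (refl; sym; trans; cong; cong₂; subst)
open import Data.Nat.Tactic.RingSolver using (solve-∀)

mutual
  leftEdges : BT → ℕ
  leftEdges leaf = 0
  leftEdges (node l r) = leftEdges⁺ l + leftEdges r

  -- also counts the edge into the root, for t hanging as a left child
  leftEdges⁺ : BT → ℕ
  leftEdges⁺ leaf = 0
  leftEdges⁺ t@(node _ _) = suc (leftEdges t)

leftEdges≤leftEdges⁺ : ∀ t → leftEdges t ≤ leftEdges⁺ t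
leftEdges≤leftEdges⁺ leaf = z≤n
leftEdges≤leftEdges⁺ (node l r) = n≤1+n _

leftEdges⁺≤1+leftEdges : ∀ t → leftEdges⁺ t ≤ suc (leftEdges t)
leftEdges⁺≤1+leftEdges leaf = z≤n
leftEdges⁺≤1+leftEdges (node l r) = ≤-refl

leftEdges-lc : ∀ L Rv Rs →
  leftEdges (lc L Rv Rs) ≡ leftEdges (node L Rv) + sum (map (suc ∘ leftEdges) Rs)
leftEdges-lc L Rv [] = sym (+-identityʳ _)
leftEdges-lc L Rv (R ∷ Rs) =
  trans (leftEdges-lc (node L Rv) R Rs)
        (shift (leftEdges (node L Rv)) (leftEdges R) (sum (map (suc ∘ leftEdges) Rs)))
  where
  shift : ∀ a b c → suc a + b + c ≡ a + (suc b + c)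
  shift = solve-∀

leftEdges-rc : ∀ R Lv Ls →
  leftEdges (rc R Lv Ls) ≡ leftEdges (node Lv R) + sum (map leftEdges⁺ Ls)
leftEdges-rc R Lv [] = sym (+-identityʳ _)
leftEdges-rc R Lv (L ∷ Ls) =
  trans (leftEdges-rc (node Lv R) L Ls)
        (swap (leftEdges⁺ L) (leftEdges (node Lv R)) (sum (map leftEdges⁺ Ls)))
  where
  swap : ∀ a b c → a + b + c ≡ b + (a + c)
  swap = solve-∀

leftEdges⁺-lc : ∀ L Rv Rs → leftEdges⁺ (lc L Rv Rs) ≡ suc (leftEdges (lc L Rv Rs))
leftEdges⁺-lc L Rv [] = refl
leftEdges⁺-lc L Rv (R ∷ Rs) = leftEdges⁺-lc (node L Rv) R Rs

leftEdges⁺-rc : ∀ R Lv Ls → leftEdges⁺ (rc R Lv Ls) ≡ suc (leftEdges (rc R Lv Ls))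
leftEdges⁺-rc R Lv [] = refl
leftEdges⁺-rc R Lv (L ∷ Ls) = leftEdges⁺-rc (node Lv R) L Ls

leftEdges-rootRot : ∀ {s t} → RootRot s t → leftEdges s ≤ suc (leftEdges t)
leftEdges-rootRot (dirL A L Rv Rs) = ≤-trans (begin
  leftEdges⁺ A + leftEdges (lc L Rv Rs)                ≡⟨ cong (leftEdges⁺ A +_) (leftEdges-lc L Rv Rs) ⟩
  leftEdges⁺ A + (leftEdges⁺ L + leftEdges Rv + σ)    ≤⟨ +-monoʳ-≤ (leftEdges⁺ A)
                                                          (+-monoˡ-≤ σ (+-monoˡ-≤ (leftEdges Rv) (leftEdges⁺≤1+leftEdges L))) ⟩
  leftEdges⁺ A + (suc (leftEdges L) + leftEdges Rv + σ) ≡⟨ regroup (leftEdges⁺ A) (leftEdges L) (leftEdges Rv) σ ⟩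
  suc (leftEdges⁺ A + leftEdges L) + leftEdges Rv + σ  ≡⟨ sym (leftEdges-lc (node A L) Rv Rs) ⟩
  leftEdges (lc (node A L) Rv Rs)                      ∎) (n≤1+n _)
  where
  open ≤-Reasoning
  σ = sum (map (suc ∘ leftEdges) Rs)
  regroup : ∀ a l v s → a + (suc l + v + s) ≡ suc (a + l) + v + s
  regroup = solve-∀
leftEdges-rootRot (invL A B Rv Rs) = begin
  leftEdges (lc (node A B) Rv Rs)                     ≡⟨ leftEdges-lc (node A B) Rv Rs ⟩
  suc (leftEdges⁺ A + leftEdges B) + leftEdges Rv + σ ≡⟨ regroup (leftEdges⁺ A) (leftEdges B) (leftEdges Rv) σ ⟩
  suc (leftEdges⁺ A + (leftEdges B + leftEdges Rv + σ)) ≤⟨ s≤s (+-monoʳ-≤ (leftEdges⁺ A)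
                                                          (+-monoˡ-≤ σ (+-monoˡ-≤ (leftEdges Rv) (leftEdges≤leftEdges⁺ B)))) ⟩
  suc (leftEdges⁺ A + (leftEdges⁺ B + leftEdges Rv + σ)) ≡⟨ cong (suc ∘ (leftEdges⁺ A +_)) (sym (leftEdges-lc B Rv Rs)) ⟩
  suc (leftEdges⁺ A + leftEdges (lc B Rv Rs))          ∎
  where
  open ≤-Reasoning
  σ = sum (map (suc ∘ leftEdges) Rs)
  regroup : ∀ a b v s → suc (a + b) + v + s ≡ suc (a + (b + v + s))
  regroup = solve-∀
leftEdges-rootRot (dirR A R Lv Ls) = begin
  leftEdges⁺ (rc R Lv Ls) + leftEdges A                 ≡⟨ cong (_+ leftEdges A) (leftEdges⁺-rc R Lv Ls) ⟩
  suc (leftEdges (rc R Lv Ls)) + leftEdges A            ≡⟨ cong (λ x → suc x + leftEdges A) (leftEdges-rc R Lv Ls) ⟩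
  suc (leftEdges⁺ Lv + leftEdges R + τ) + leftEdges A   ≡⟨ regroup (leftEdges⁺ Lv) (leftEdges R) (leftEdges A) τ ⟩
  suc (leftEdges⁺ Lv + (leftEdges R + leftEdges A) + τ) ≤⟨ s≤s (+-monoˡ-≤ τ (+-monoʳ-≤ (leftEdges⁺ Lv)
                                                           (+-monoˡ-≤ (leftEdges A) (leftEdges≤leftEdges⁺ R)))) ⟩
  suc (leftEdges⁺ Lv + (leftEdges⁺ R + leftEdges A) + τ) ≡⟨ cong suc (sym (leftEdges-rc (node R A) Lv Ls)) ⟩
  suc (leftEdges (rc (node R A) Lv Ls))                  ∎
  where
  open ≤-Reasoning
  τ = sum (map leftEdges⁺ Ls)
  regroup : ∀ v r a t → suc (v + r + t) + a ≡ suc (v + (r + a) + t)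
  regroup = solve-∀
leftEdges-rootRot (invR A B Lv Ls) = ≤-trans (begin
  leftEdges (rc (node B A) Lv Ls)                        ≡⟨ leftEdges-rc (node B A) Lv Ls ⟩
  leftEdges⁺ Lv + (leftEdges⁺ B + leftEdges A) + τ       ≤⟨ +-monoˡ-≤ τ (+-monoʳ-≤ (leftEdges⁺ Lv)
                                                           (+-monoˡ-≤ (leftEdges A) (leftEdges⁺≤1+leftEdges B))) ⟩
  leftEdges⁺ Lv + (suc (leftEdges B) + leftEdges A) + τ  ≡⟨ regroup (leftEdges⁺ Lv) (leftEdges B) (leftEdges A) τ ⟩
  suc (leftEdges⁺ Lv + leftEdges B + τ) + leftEdges A    ≡⟨ cong (λ x → suc x + leftEdges A) (sym (leftEdges-rc B Lv Ls)) ⟩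
  suc (leftEdges (rc B Lv Ls)) + leftEdges A             ≡⟨ cong (_+ leftEdges A) (sym (leftEdges⁺-rc B Lv Ls)) ⟩
  leftEdges⁺ (rc B Lv Ls) + leftEdges A                  ∎) (n≤1+n _)
  where
  open ≤-Reasoning
  τ = sum (map leftEdges⁺ Ls)
  regroup : ∀ v b a t → v + (suc b + a) + t ≡ suc (v + b + t) + a
  regroup = solve-∀

leftEdges⁺-rootRot-target : ∀ {s t} → RootRot s t → leftEdges⁺ t ≡ suc (leftEdges t)
leftEdges⁺-rootRot-target (dirL A L Rv Rs) = leftEdges⁺-lc (node A L) Rv Rs
leftEdges⁺-rootRot-target (invL A B Rv Rs) = refl
leftEdges⁺-rootRot-target (dirR A R Lv Ls) = leftEdges⁺-rc (node R A) Lv Ls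
leftEdges⁺-rootRot-target (invR A B Lv Ls) = refl

leftEdges⁺-crot-target : ∀ {s t} → CRot s t → leftEdges⁺ t ≡ suc (leftEdges t)
leftEdges⁺-crot-target (here r) = leftEdges⁺-rootRot-target r
leftEdges⁺-crot-target (inL _) = refl
leftEdges⁺-crot-target (inR _) = refl

mutual
  leftEdges-crot : ∀ {s t} → CRot s t → leftEdges s ≤ suc (leftEdges t)
  leftEdges-crot (here r) = leftEdges-rootRot r
  leftEdges-crot (inL {r = r} c) = +-monoˡ-≤ (leftEdges r) (leftEdges⁺-crot c)
  leftEdges-crot (inR {l = l} {r' = r'} c) =
    ≤-trans (+-monoʳ-≤ (leftEdges⁺ l) (leftEdges-crot c)) (≤-reflexive (+-suc (leftEdges⁺ l) (leftEdges r')))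

  leftEdges⁺-crot : ∀ {s t} → CRot s t → leftEdges⁺ s ≤ suc (leftEdges⁺ t)
  leftEdges⁺-crot {s} {t} c = begin
    leftEdges⁺ s             ≤⟨ leftEdges⁺≤1+leftEdges s ⟩
    suc (leftEdges s)        ≤⟨ s≤s (leftEdges-crot c) ⟩
    suc (suc (leftEdges t))  ≡⟨ cong suc (sym (leftEdges⁺-crot-target c)) ⟩
    suc (leftEdges⁺ t)       ∎
    where open ≤-Reasoning

leftEdges-steps : ∀ {k s t} → Steps k s t → leftEdges s ≤ leftEdges t + k
leftEdges-steps done = ≤-reflexive (sym (+-identityʳ _))
leftEdges-steps {t = t} (step {k = k} c st) =
  ≤-trans (leftEdges-crot c) (≤-trans (s≤s (leftEdges-steps st)) (≤-reflexive (sym (+-suc (leftEdges t) k))))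

chainDist≥leftEdges∸leftEdges : ∀ s t → ChainDistAtLeast (leftEdges s ∸ leftEdges t) s t
chainDist≥leftEdges∸leftEdges s t k st = m≤n+o⇒m∸n≤o (leftEdges s) (leftEdges t) (leftEdges-steps st)

leftPath : ℕ → BT
leftPath zero = leaf
leftPath (suc n) = node (leftPath n) leaf

rightPath : ℕ → BT
rightPath zero = leaf
rightPath (suc n) = node leaf (rightPath n)

size-leftPath : ∀ n → size (leftPath n) ≡ n
size-leftPath zero = refl
size-leftPath (suc n) = trans (+-comm (size (leftPath n)) 1) (cong suc (size-leftPath n))

size-rightPath : ∀ n → size (rightPath n) ≡ n
size-rightPath zero = refl
size-rightPath (suc n) = cong suc (size-rightPath n)

leftEdges-leftPath : ∀ n → leftEdges (leftPath (suc n)) ≡ n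
leftEdges-leftPath zero = refl
leftEdges-leftPath (suc n) = trans (+-identityʳ _) (cong suc (leftEdges-leftPath n))

leftEdges-rightPath : ∀ n → leftEdges (rightPath n) ≡ 0
leftEdges-rightPath zero = refl
leftEdges-rightPath (suc n) = leftEdges-rightPath n

Sub⇒⊆ : ∀ {t s} → Sub t s → vertices s ⊆ vertices t
Sub⇒⊆ here = λ p → p
Sub⇒⊆ (inL sub) = ∈-++⁺ˡ ∘ Sub⇒⊆ sub
Sub⇒⊆ (inR {l = l} sub) = ∈-++⁺ʳ (vertices l) ∘ there ∘ Sub⇒⊆ sub

1∈leftPath : ∀ n → 1 ∈ vertices (label 0 (leftPath (suc n)))
1∈leftPath zero = here refl
1∈leftPath (suc n) = ∈-++⁺ˡ (1∈leftPath n)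

1∈subtree-leftPath : ∀ n {s} → Sub (label 0 (leftPath n)) s → 1 ∈ vertices s
1∈subtree-leftPath (suc n) here = 1∈leftPath n
1∈subtree-leftPath (suc n) (inL sub) = 1∈subtree-leftPath n sub

vertices-rightPath-> : ∀ o n {x} → x ∈ vertices (label o (rightPath n)) → o < x
vertices-rightPath-> o (suc n) (here refl) = m<m+n o (s≤s z≤n)
vertices-rightPath-> o (suc n) (there p) = <-trans (m<m+n o (s≤s z≤n)) (vertices-rightPath-> (o + 1) n p)

paths-noEquivalentEdges : ∀ n →
  NoEquivalentEdges (label 0 (leftPath (suc n))) (label 0 (rightPath (suc n)))
paths-noEquivalentEdges n s t (viaL subS) (viaR subT) s≈t =
  <-irrefl refl (vertices-rightPath-> 1 n (Sub⇒⊆ subT (Equivalence.to (s≈t 1) (1∈subtree-leftPath n subS))))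

proposition6 : (n : ℕ) → 1 ≤ n →
    Σ BT (λ S → Σ BT (λ T →
    size S ≡ n × size T ≡ n
    × NoEquivalentEdges (label 0 S) (label 0 T)
    × ChainDistAtLeast (n ∸ 1) S T))
proposition6 (suc n) _ =
  leftPath (suc n) , rightPath (suc n) , size-leftPath (suc n) , size-rightPath (suc n) ,
  paths-noEquivalentEdges n ,
  subst (λ d → ChainDistAtLeast d (leftPath (suc n)) (rightPath (suc n)))
        (cong₂ _∸_ (leftEdges-leftPath n) (leftEdges-rightPath (suc n)))
        (chainDist≥leftEdges∸leftEdges (leftPath (suc n)) (rightPath (suc n)))
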